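{- Let $\mathcal{C}$ be a category with an $(\mathcal{E},\mathcal{M})$-factorization system, $F\colon\mathcal{C}\to\mathcal{C}$ a functor and $I$ an object of $\mathcal{C}$. (1) If $h\colon(C,c,i_C)\to(D,d,i_D)$ is a pointed coalgebra morphism with $h\in\mathcal{M}$ between two $\mathcal{M}$-reachable pointed $F$-coalgebras, then $h$ is an isomorphism. (2) If $\mathcal{C}$ has $\mathcal{M}$-intersections and $F$ preserves them weakly, then every pointed $F$-coalgebra has at most one $\mathcal{M}$-reachable $\mathcal{M}$-subcoalgebra up to isomorphism: if $g\colon(R,r,i_R)\to(C,c,i_C)$ and $h\colon(S,s,i_S)\to(C,c,i_C)$ are pointed coalgebra morphisms in $\mathcal{M}$ with $(R,r,i_R)$ and $(S,s,i_S)$ both $\mathcal{M}$-reachable, then $(R,r,i_R)\cong(S,s,i_S)$ as pointed coalgebras.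
   Context: An $(\mathcal{E},\mathcal{M})$-factorization system on $\mathcal{C}$: classes $\mathcal{E},\mathcal{M}$ of morphisms, closed under composition and containing all isomorphisms, such that every morphism factors as $m\cdot e$ with $e\in\mathcal{E}$, $m\in\mathcal{M}$, and every commutative square $g\cdot e=m\cdot f$ with $e\in\mathcal{E}$, $m\in\mathcal{M}$ has a unique diagonal $d$ with $m\cdot d=g$, $d\cdot e=f$ ($\mathcal{M}$ need not consist of monomorphisms). A pointed $F$-coalgebra is $(C,c,i_C)$ with $c\colon C\to FC$, $i_C\colon I\to C$; a pointed coalgebra morphism $h\colon(C,c,i_C)\to(D,d,i_D)$ is $h\colon C\to D$ with $d\cdot h=Fh\cdot c$ and $h\cdot i_C=i_D$. A split epimorphism of pointed coalgebras is a pointed coalgebra morphism $h$ with a pointed coalgebra morphism $s$ such that $h\cdot s=\mathrm{id}$. An $\mathcal{M}$-subcoalgebra of $(C,c,i_C)$ is a pointed coalgebra morphism into it whose underlying morphism is in $\mathcal{M}$. $(C,c,i_C)$ is $\mathcal{M}$-reachable if every $\mathcal{M}$-subcoalgebra of it is a split epimorphism of pointed coalgebras. An $\mathcal{M}$-intersection is a pullback of a morphism in $\mathcal{M}$ along a morphism in $\mathcal{M}$; $\mathcal{C}$ has them if all such pullbacks exist, and $F$ preserves them weakly if it maps such pullback squares to weak pullback squares. -}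

module Defs where

open import Level using (Level; _⊔_) renaming (suc to lsuc)
open import Data.Product using (Σ; Σ-syntax; _×_; _,_)
open import Relation.Binary.Structures using (IsEquivalence)

record Category (o ℓ e : Level) : Set (lsuc (o ⊔ ℓ ⊔ e)) where
  infixr 9 _∘_
  infix  4 _≈_
  field
    Obj       : Set o
    _⇒_       : Obj → Obj → Set ℓ
    _≈_       : ∀ {A B} → A ⇒ B → A ⇒ B → Set e
    id        : ∀ {A} → A ⇒ A
    _∘_       : ∀ {A B C} → B ⇒ C → A ⇒ B → A ⇒ C
    equiv     : ∀ {A B} → IsEquivalence (_≈_ {A} {B})
    ∘-resp-≈  : ∀ {A B C} {f h : B ⇒ C} {g i : A ⇒ B} → f ≈ h → g ≈ i → f ∘ g ≈ h ∘ i
    assoc     : ∀ {A B C D} {f : A ⇒ B} {g : B ⇒ C} {h : C ⇒ D} →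
                (h ∘ g) ∘ f ≈ h ∘ (g ∘ f)
    identityˡ : ∀ {A B} {f : A ⇒ B} → id ∘ f ≈ f
    identityʳ : ∀ {A B} {f : A ⇒ B} → f ∘ id ≈ f

module _ {o ℓ e : Level} (𝒞 : Category o ℓ e) where
  open Category 𝒞

  record IsIso {A B : Obj} (f : A ⇒ B) : Set (ℓ ⊔ e) where
    field
      inv  : B ⇒ A
      isoˡ : inv ∘ f ≈ id
      isoʳ : f ∘ inv ≈ id

  MorClass : (p : Level) → Set (o ⊔ ℓ ⊔ lsuc p)
  MorClass p = ∀ {A B : Obj} → A ⇒ B → Set p

  record FactorizationSystem (p q : Level) : Set (o ⊔ ℓ ⊔ e ⊔ lsuc (p ⊔ q)) where
    field
      E       : ∀ {A B : Obj} → A ⇒ B → Set p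
      M       : ∀ {A B : Obj} → A ⇒ B → Set q
      E-resp  : ∀ {A B} {f g : A ⇒ B} → f ≈ g → E f → E g
      M-resp  : ∀ {A B} {f g : A ⇒ B} → f ≈ g → M f → M g
      E-comp  : ∀ {A B C} {f : B ⇒ C} {g : A ⇒ B} → E f → E g → E (f ∘ g)
      M-comp  : ∀ {A B C} {f : B ⇒ C} {g : A ⇒ B} → M f → M g → M (f ∘ g)
      E-iso   : ∀ {A B} {f : A ⇒ B} → IsIso f → E f
      M-iso   : ∀ {A B} {f : A ⇒ B} → IsIso f → M f
      factor  : ∀ {A B} (f : A ⇒ B) →
                Σ[ X ∈ Obj ] Σ[ ε ∈ A ⇒ X ] Σ[ μ ∈ X ⇒ B ]
                  (E ε × M μ × μ ∘ ε ≈ f)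
      diag    : ∀ {A B C D} {e′ : A ⇒ B} {m : C ⇒ D} {f : A ⇒ C} {g : B ⇒ D} →
                E e′ → M m → g ∘ e′ ≈ m ∘ f →
                Σ[ d ∈ B ⇒ C ] ((m ∘ d ≈ g × d ∘ e′ ≈ f) ×
                  (∀ (d′ : B ⇒ C) → m ∘ d′ ≈ g → d′ ∘ e′ ≈ f → d′ ≈ d))

  record IsWeakPullback {A B C P : Obj} (f : A ⇒ C) (g : B ⇒ C)
                        (p₁ : P ⇒ A) (p₂ : P ⇒ B) : Set (o ⊔ ℓ ⊔ e) where
    field
      commute : f ∘ p₁ ≈ g ∘ p₂
      factor  : ∀ {Q} (q₁ : Q ⇒ A) (q₂ : Q ⇒ B) → f ∘ q₁ ≈ g ∘ q₂ →
                Σ[ u ∈ Q ⇒ P ] (p₁ ∘ u ≈ q₁ × p₂ ∘ u ≈ q₂)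

  record IsPullback {A B C P : Obj} (f : A ⇒ C) (g : B ⇒ C)
                    (p₁ : P ⇒ A) (p₂ : P ⇒ B) : Set (o ⊔ ℓ ⊔ e) where
    field
      commute : f ∘ p₁ ≈ g ∘ p₂
      factor  : ∀ {Q} (q₁ : Q ⇒ A) (q₂ : Q ⇒ B) → f ∘ q₁ ≈ g ∘ q₂ →
                Σ[ u ∈ Q ⇒ P ] ((p₁ ∘ u ≈ q₁ × p₂ ∘ u ≈ q₂) ×
                  (∀ (u′ : Q ⇒ P) → p₁ ∘ u′ ≈ q₁ → p₂ ∘ u′ ≈ q₂ → u′ ≈ u))

  record Pullback {A B C : Obj} (f : A ⇒ C) (g : B ⇒ C) : Set (o ⊔ ℓ ⊔ e) where
    field
      P          : Obj
      p₁         : P ⇒ A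
      p₂         : P ⇒ B
      isPullback : IsPullback f g p₁ p₂

record Endofunctor {o ℓ e : Level} (𝒞 : Category o ℓ e) : Set (o ⊔ ℓ ⊔ e) where
  open Category 𝒞
  field
    F₀           : Obj → Obj
    F₁           : ∀ {A B} → A ⇒ B → F₀ A ⇒ F₀ B
    identity     : ∀ {A} → F₁ (id {A}) ≈ id
    homomorphism : ∀ {A B C} {f : A ⇒ B} {g : B ⇒ C} → F₁ (g ∘ f) ≈ F₁ g ∘ F₁ f
    F-resp-≈     : ∀ {A B} {f g : A ⇒ B} → f ≈ g → F₁ f ≈ F₁ g

module _ {o ℓ e p q : Level} {𝒞 : Category o ℓ e}
         (FS : FactorizationSystem 𝒞 p q) where
  open Category 𝒞
  open FactorizationSystem FS

  HasMIntersections : Set (o ⊔ ℓ ⊔ e ⊔ q)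
  HasMIntersections = ∀ {A B C} (m₁ : A ⇒ C) (m₂ : B ⇒ C) → M m₁ → M m₂ → Pullback 𝒞 m₁ m₂

  PreservesMIntersectionsWeakly : Endofunctor 𝒞 → Set (o ⊔ ℓ ⊔ e ⊔ q)
  PreservesMIntersectionsWeakly F =
    ∀ {A B C P} (m₁ : A ⇒ C) (m₂ : B ⇒ C) (p₁ : P ⇒ A) (p₂ : P ⇒ B) →
    M m₁ → M m₂ → IsPullback 𝒞 m₁ m₂ p₁ p₂ →
    IsWeakPullback 𝒞 (F₁ m₁) (F₁ m₂) (F₁ p₁) (F₁ p₂)
    where open Endofunctor F

module _ {o ℓ e : Level} {𝒞 : Category o ℓ e} (F : Endofunctor 𝒞)
         (I : Category.Obj 𝒞) where
  open Category 𝒞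
  open Endofunctor F

  record PointedCoalgebra : Set (o ⊔ ℓ) where
    field
      carrier : Obj
      str     : carrier ⇒ F₀ carrier
      point   : I ⇒ carrier

  open PointedCoalgebra

  record PointedCoalgebraHom (X Y : PointedCoalgebra) : Set (ℓ ⊔ e) where
    field
      hom      : carrier X ⇒ carrier Y
      commutes : str Y ∘ hom ≈ F₁ hom ∘ str X
      pointed  : hom ∘ point X ≈ point Y

  open PointedCoalgebraHom

  record IsSplitEpi {X Y : PointedCoalgebra} (h : PointedCoalgebraHom X Y) : Set (ℓ ⊔ e) where
    field
      section : PointedCoalgebraHom Y X
      split   : hom h ∘ hom section ≈ id

  record IsCoalgebraIso {X Y : PointedCoalgebra} (h : PointedCoalgebraHom X Y) : Set (ℓ ⊔ e) where
    field
      inverse : PointedCoalgebraHom Y X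
      isoˡ    : hom inverse ∘ hom h ≈ id
      isoʳ    : hom h ∘ hom inverse ≈ id

  _≅_ : PointedCoalgebra → PointedCoalgebra → Set (ℓ ⊔ e)
  X ≅ Y = Σ[ h ∈ PointedCoalgebraHom X Y ] IsCoalgebraIso h

  module _ {p q : Level} (FS : FactorizationSystem 𝒞 p q) where
    open FactorizationSystem FS

    IsMReachable : PointedCoalgebra → Set (o ⊔ ℓ ⊔ e ⊔ q)
    IsMReachable X = ∀ (Y : PointedCoalgebra) (h : PointedCoalgebraHom Y X) →
                     M (hom h) → IsSplitEpi h

{-# OPTIONS --safe #-}
module Submission where

-- (1) If h : X → Y is in M and Y is M-reachable, h has a coalgebra section s;
-- s is again in M (M is left-cancellable by M-morphisms), so reachability of X
-- gives a section t of s, and then h ≈ t makes s a two-sided inverse of h.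
-- (2) Intersect the two M-subcoalgebras: by weak preservation the pullback P
-- carries a pointed coalgebra structure making both projections coalgebra
-- morphisms, and P → R is in M because M is pullback-stable.  Reachability of R
-- splits it by some σ, the composite R → P → S is in M, and (1) applies.

open import Defs
open import Level using (Level; _⊔_)
open import Data.Product using (Σ-syntax; _×_; _,_; proj₁; proj₂)
open import Relation.Binary.Bundles using (Setoid)
open import Relation.Binary.Structures using (IsEquivalence)
import Relation.Binary.Reasoning.Setoid as SetoidReasoning

module CategoryProperties {o ℓ e : Level} (𝒞 : Category o ℓ e) where
  open Category 𝒞

  hom-setoid : Obj → Obj → Setoid ℓ e
  hom-setoid A B = record { Carrier = A ⇒ B ; _≈_ = _≈_ ; isEquivalence = equiv }

  module _ {A B : Obj} where
    open IsEquivalence (equiv {A} {B}) public using (refl; sym; trans)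
    open SetoidReasoning (hom-setoid A B) public

  ∘-resp-≈ˡ : ∀ {A B C} {f h : B ⇒ C} {g : A ⇒ B} → f ≈ h → f ∘ g ≈ h ∘ g
  ∘-resp-≈ˡ f≈h = ∘-resp-≈ f≈h refl

  ∘-resp-≈ʳ : ∀ {A B C} {f : B ⇒ C} {g h : A ⇒ B} → g ≈ h → f ∘ g ≈ f ∘ h
  ∘-resp-≈ʳ g≈h = ∘-resp-≈ refl g≈h

  id-iso : ∀ {A} → IsIso 𝒞 (id {A})
  id-iso = record { inv = id ; isoˡ = identityˡ ; isoʳ = identityˡ }

  left-inverse≈right-inverse : ∀ {A B} {s : A ⇒ B} {h t : B ⇒ A} →
                               h ∘ s ≈ id → s ∘ t ≈ id → h ≈ t
  left-inverse≈right-inverse {s = s} {h} {t} hs≈id st≈id = begin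
    h            ≈⟨ sym identityʳ ⟩
    h ∘ id       ≈⟨ ∘-resp-≈ʳ (sym st≈id) ⟩
    h ∘ (s ∘ t)  ≈⟨ sym assoc ⟩
    (h ∘ s) ∘ t  ≈⟨ ∘-resp-≈ˡ hs≈id ⟩
    id ∘ t       ≈⟨ identityˡ ⟩
    t            ∎

  pullback-jointly-monic : ∀ {A B C P Q} {f : A ⇒ C} {g : B ⇒ C} {p₁ : P ⇒ A} {p₂ : P ⇒ B}
                           {a b : Q ⇒ P} → IsPullback 𝒞 f g p₁ p₂ →
                           p₁ ∘ a ≈ p₁ ∘ b → p₂ ∘ a ≈ p₂ ∘ b → a ≈ b
  pullback-jointly-monic {f = f} {g} {p₁} {p₂} {b = b} pb p₁a≈p₁b p₂a≈p₂b
    with IsPullback.factor pb (p₁ ∘ b) (p₂ ∘ b) square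
    where
      square : f ∘ (p₁ ∘ b) ≈ g ∘ (p₂ ∘ b)
      square = trans (sym assoc) (trans (∘-resp-≈ˡ (IsPullback.commute pb)) assoc)
  ... | _ , _ , unique = trans (unique _ p₁a≈p₁b p₂a≈p₂b) (sym (unique b refl refl))

module FactorizationProperties {o ℓ e p q : Level} {𝒞 : Category o ℓ e}
                               (FS : FactorizationSystem 𝒞 p q) where
  open Category 𝒞
  open CategoryProperties 𝒞
  open FactorizationSystem FS

  E-M-cancel : ∀ {A B C D} {ε : A ⇒ B} {μ : C ⇒ D} {x y : B ⇒ C} → E ε → M μ →
               μ ∘ x ≈ μ ∘ y → x ∘ ε ≈ y ∘ ε → x ≈ y
  E-M-cancel {ε = ε} {μ} {x} {y} εE μM μx≈μy xε≈yε with diag εE μM (assoc {f = ε} {x} {μ})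
  ... | _ , _ , unique = trans (unique x refl refl) (sym (unique y (sym μx≈μy) (sym xε≈yε)))

  LiftsAgainstE : ∀ {A B} → A ⇒ B → Set (o ⊔ ℓ ⊔ e ⊔ p)
  LiftsAgainstE {A} {B} f = ∀ {C D} {ε : C ⇒ D} {x : C ⇒ A} {y : D ⇒ B} →
                            E ε → y ∘ ε ≈ f ∘ x → Σ[ d ∈ D ⇒ A ] (f ∘ d ≈ y × d ∘ ε ≈ x)

  M⇒lifts : ∀ {A B} {f : A ⇒ B} → M f → LiftsAgainstE f
  M⇒lifts fM εE square with diag εE fM square
  ... | d , lifting , _ = d , lifting

  -- Mere existence of lifts suffices: the lift d inverts the E-part ε of f,
  -- by uniqueness of diagonals against the M-part μ.
  lifts⇒M : ∀ {A B} {f : A ⇒ B} → LiftsAgainstE f → M f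
  lifts⇒M {f = f} lifts with factor f
  ... | _ , ε , μ , εE , μM , με≈f with lifts εE (trans με≈f (sym identityʳ))
  ...   | d , fd≈μ , dε≈id = M-resp με≈f (M-comp μM (M-iso ε-iso))
    where
      μεd≈μ : μ ∘ (ε ∘ d) ≈ μ ∘ id
      μεd≈μ = begin
        μ ∘ (ε ∘ d)  ≈⟨ sym assoc ⟩
        (μ ∘ ε) ∘ d  ≈⟨ ∘-resp-≈ˡ με≈f ⟩
        f ∘ d        ≈⟨ fd≈μ ⟩
        μ            ≈⟨ sym identityʳ ⟩
        μ ∘ id       ∎

      εdε≈ε : (ε ∘ d) ∘ ε ≈ id ∘ ε
      εdε≈ε = begin
        (ε ∘ d) ∘ ε  ≈⟨ assoc ⟩
        ε ∘ (d ∘ ε)  ≈⟨ ∘-resp-≈ʳ dε≈id ⟩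
        ε ∘ id       ≈⟨ identityʳ ⟩
        ε            ≈⟨ sym identityˡ ⟩
        id ∘ ε       ∎

      ε-iso : IsIso 𝒞 ε
      ε-iso = record { inv = d ; isoˡ = dε≈id ; isoʳ = E-M-cancel εE μM μεd≈μ εdε≈ε }

  M-cancelˡ : ∀ {A B C} {f : A ⇒ B} {m : B ⇒ C} → M (m ∘ f) → M m → M f
  M-cancelˡ {f = f} {m} mfM mM = lifts⇒M lift
    where
      lift : LiftsAgainstE f
      lift {ε = ε} {x} {y} εE yε≈fx with M⇒lifts mfM εE square
        where
          square : (m ∘ y) ∘ ε ≈ (m ∘ f) ∘ x
          square = begin
            (m ∘ y) ∘ ε  ≈⟨ assoc ⟩
            m ∘ (y ∘ ε)  ≈⟨ ∘-resp-≈ʳ yε≈fx ⟩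
            m ∘ (f ∘ x)  ≈⟨ sym assoc ⟩
            (m ∘ f) ∘ x  ∎
      ... | d , mfd≈my , dε≈x = d , E-M-cancel εE mM (trans (sym assoc) mfd≈my) fdε≈yε , dε≈x
        where
          fdε≈yε : (f ∘ d) ∘ ε ≈ y ∘ ε
          fdε≈yε = trans assoc (trans (∘-resp-≈ʳ dε≈x) (sym yε≈fx))

  section-of-M : ∀ {A B} {h : A ⇒ B} {s : B ⇒ A} → M h → h ∘ s ≈ id → M s
  section-of-M hM hs≈id = M-cancelˡ (M-resp (sym hs≈id) (M-iso id-iso)) hM

  M-pullback-stable : ∀ {A B C P} {g : A ⇒ C} {h : B ⇒ C} {p₁ : P ⇒ A} {p₂ : P ⇒ B} →
                      IsPullback 𝒞 g h p₁ p₂ → M h → M p₁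
  M-pullback-stable {g = g} {h} {p₁} {p₂} pb hM = lifts⇒M lift
    where
      open IsPullback pb using (commute)

      lift : LiftsAgainstE p₁
      lift {ε = ε} {x} {y} εE yε≈p₁x with M⇒lifts hM εE square
        where
          square : (g ∘ y) ∘ ε ≈ h ∘ (p₂ ∘ x)
          square = begin
            (g ∘ y) ∘ ε   ≈⟨ assoc ⟩
            g ∘ (y ∘ ε)   ≈⟨ ∘-resp-≈ʳ yε≈p₁x ⟩
            g ∘ (p₁ ∘ x)  ≈⟨ sym assoc ⟩
            (g ∘ p₁) ∘ x  ≈⟨ ∘-resp-≈ˡ commute ⟩
            (h ∘ p₂) ∘ x  ≈⟨ assoc ⟩
            h ∘ (p₂ ∘ x)  ∎
      ... | k , hk≈gy , kε≈p₂x with IsPullback.factor pb y k (sym hk≈gy)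
      ...   | u , (p₁u≈y , p₂u≈k) , _ = u , p₁u≈y , uε≈x
        where
          uε≈x : u ∘ ε ≈ x
          uε≈x = pullback-jointly-monic pb
                   (trans (sym assoc) (trans (∘-resp-≈ˡ p₁u≈y) yε≈p₁x))
                   (trans (sym assoc) (trans (∘-resp-≈ˡ p₂u≈k) kε≈p₂x))

module PointedCoalgebraProperties {o ℓ e : Level} {𝒞 : Category o ℓ e}
                                  (F : Endofunctor 𝒞) (I : Category.Obj 𝒞) where
  open Category 𝒞
  open CategoryProperties 𝒞
  open Endofunctor F
  open PointedCoalgebra
  open PointedCoalgebraHom

  infixr 9 _∘ᶜ_
  _∘ᶜ_ : ∀ {X Y Z} → PointedCoalgebraHom F I Y Z → PointedCoalgebraHom F I X Y →
         PointedCoalgebraHom F I X Z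
  _∘ᶜ_ {X} {Y} {Z} f g = record
    { hom      = hom f ∘ hom g
    ; commutes = begin
        str Z ∘ (hom f ∘ hom g)           ≈⟨ sym assoc ⟩
        (str Z ∘ hom f) ∘ hom g           ≈⟨ ∘-resp-≈ˡ (commutes f) ⟩
        (F₁ (hom f) ∘ str Y) ∘ hom g      ≈⟨ assoc ⟩
        F₁ (hom f) ∘ (str Y ∘ hom g)      ≈⟨ ∘-resp-≈ʳ (commutes g) ⟩
        F₁ (hom f) ∘ (F₁ (hom g) ∘ str X) ≈⟨ sym assoc ⟩
        (F₁ (hom f) ∘ F₁ (hom g)) ∘ str X ≈⟨ ∘-resp-≈ˡ (sym homomorphism) ⟩
        F₁ (hom f ∘ hom g) ∘ str X        ∎
    ; pointed  = trans assoc (trans (∘-resp-≈ʳ (pointed g)) (pointed f))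
    }

  module _ {p q : Level} (FS : FactorizationSystem 𝒞 p q) where
    open FactorizationSystem FS
    open FactorizationProperties FS

    reachable-M-hom⇒iso : ∀ {X Y} (h : PointedCoalgebraHom F I X Y) → M (hom h) →
                          IsMReachable F I FS X → IsMReachable F I FS Y →
                          IsCoalgebraIso F I h
    reachable-M-hom⇒iso {X} {Y} h hM X-reachable Y-reachable =
      record { inverse = s ; isoˡ = sh≈id ; isoʳ = hs≈id }
      where
        open IsSplitEpi (Y-reachable X h hM) renaming (section to s; split to hs≈id)
        open IsSplitEpi (X-reachable Y s (section-of-M hM hs≈id))
          renaming (section to t; split to st≈id)

        sh≈id : hom s ∘ hom h ≈ id
        sh≈id = trans (∘-resp-≈ʳ (left-inverse≈right-inverse hs≈id st≈id)) st≈id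

    module Intersection (F-preserves : PreservesMIntersectionsWeakly FS F)
                        {X R S : PointedCoalgebra F I}
                        (g : PointedCoalgebraHom F I R X) (h : PointedCoalgebraHom F I S X)
                        (gM : M (hom g)) (hM : M (hom h))
                        (pb : Pullback 𝒞 (hom g) (hom h)) where
      open Pullback pb

      str-square : F₁ (hom g) ∘ (str R ∘ p₁) ≈ F₁ (hom h) ∘ (str S ∘ p₂)
      str-square = begin
        F₁ (hom g) ∘ (str R ∘ p₁)  ≈⟨ sym assoc ⟩
        (F₁ (hom g) ∘ str R) ∘ p₁  ≈⟨ ∘-resp-≈ˡ (sym (commutes g)) ⟩
        (str X ∘ hom g) ∘ p₁       ≈⟨ assoc ⟩
        str X ∘ (hom g ∘ p₁)       ≈⟨ ∘-resp-≈ʳ (IsPullback.commute isPullback) ⟩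
        str X ∘ (hom h ∘ p₂)       ≈⟨ sym assoc ⟩
        (str X ∘ hom h) ∘ p₂       ≈⟨ ∘-resp-≈ˡ (commutes h) ⟩
        (F₁ (hom h) ∘ str S) ∘ p₂  ≈⟨ assoc ⟩
        F₁ (hom h) ∘ (str S ∘ p₂)  ∎

      intersection-str : Σ[ ξ ∈ P ⇒ F₀ P ] (F₁ p₁ ∘ ξ ≈ str R ∘ p₁ × F₁ p₂ ∘ ξ ≈ str S ∘ p₂)
      intersection-str = IsWeakPullback.factor
        (F-preserves (hom g) (hom h) p₁ p₂ gM hM isPullback) (str R ∘ p₁) (str S ∘ p₂) str-square

      intersection-point : Σ[ i ∈ I ⇒ P ] (p₁ ∘ i ≈ point R × p₂ ∘ i ≈ point S)
      intersection-point with IsPullback.factor isPullback (point R) (point S)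
                                (trans (pointed g) (sym (pointed h)))
      ... | i , projections , _ = i , projections

      intersection : PointedCoalgebra F I
      intersection = record { carrier = P ; str = proj₁ intersection-str ; point = proj₁ intersection-point }

      π₁ : PointedCoalgebraHom F I intersection R
      π₁ = record { hom      = p₁
                  ; commutes = sym (proj₁ (proj₂ intersection-str))
                  ; pointed  = proj₁ (proj₂ intersection-point) }

      π₂ : PointedCoalgebraHom F I intersection S
      π₂ = record { hom      = p₂
                  ; commutes = sym (proj₂ (proj₂ intersection-str))
                  ; pointed  = proj₂ (proj₂ intersection-point) }

    reachable-M-subcoalgebra⇒M-hom :
      HasMIntersections FS → PreservesMIntersectionsWeakly FS F →
      ∀ {X R S} (g : PointedCoalgebraHom F I R X) (h : PointedCoalgebraHom F I S X) →
      M (hom g) → M (hom h) → IsMReachable F I FS R →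
      Σ[ φ ∈ PointedCoalgebraHom F I R S ] M (hom φ)
    reachable-M-subcoalgebra⇒M-hom intersections F-preserves g h gM hM R-reachable =
      π₂ ∘ᶜ σ , M-cancelˡ (M-resp (sym hφ≈g) gM) hM
      where
        pb : Pullback 𝒞 (hom g) (hom h)
        pb = intersections (hom g) (hom h) gM hM
        open Pullback pb using (isPullback)
        open Intersection F-preserves g h gM hM pb
        open IsSplitEpi (R-reachable intersection π₁ (M-pullback-stable isPullback hM))
          renaming (section to σ; split to p₁σ≈id)

        hφ≈g : hom h ∘ (hom π₂ ∘ hom σ) ≈ hom g
        hφ≈g = begin
          hom h ∘ (hom π₂ ∘ hom σ)  ≈⟨ sym assoc ⟩
          (hom h ∘ hom π₂) ∘ hom σ  ≈⟨ ∘-resp-≈ˡ (sym (IsPullback.commute isPullback)) ⟩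
          (hom g ∘ hom π₁) ∘ hom σ  ≈⟨ assoc ⟩
          hom g ∘ (hom π₁ ∘ hom σ)  ≈⟨ ∘-resp-≈ʳ p₁σ≈id ⟩
          hom g ∘ id                ≈⟨ identityʳ ⟩
          hom g                     ∎

    reachable-M-subcoalgebras-≅ :
      HasMIntersections FS → PreservesMIntersectionsWeakly FS F →
      ∀ {X R S} (g : PointedCoalgebraHom F I R X) (h : PointedCoalgebraHom F I S X) →
      M (hom g) → M (hom h) → IsMReachable F I FS R → IsMReachable F I FS S →
      _≅_ F I R S
    reachable-M-subcoalgebras-≅ intersections F-preserves g h gM hM R-reachable S-reachable =
      let φ , φM = reachable-M-subcoalgebra⇒M-hom intersections F-preserves g h gM hM R-reachable
      in  φ , reachable-M-hom⇒iso φ φM R-reachable S-reachable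

lemma4p6 : ∀ {o ℓ e p q : Level} (𝒞 : Category o ℓ e)
    (FS : FactorizationSystem 𝒞 p q) (F : Endofunctor 𝒞) (I : Category.Obj 𝒞) →
    (∀ (X Y : PointedCoalgebra F I) (h : PointedCoalgebraHom F I X Y) →
       FactorizationSystem.M FS (PointedCoalgebraHom.hom h) →
       IsMReachable F I FS X → IsMReachable F I FS Y →
       IsCoalgebraIso F I h)
    ×
    (HasMIntersections FS → PreservesMIntersectionsWeakly FS F →
     ∀ (X R S : PointedCoalgebra F I)
       (g : PointedCoalgebraHom F I R X) (h : PointedCoalgebraHom F I S X) →
       FactorizationSystem.M FS (PointedCoalgebraHom.hom g) →
       FactorizationSystem.M FS (PointedCoalgebraHom.hom h) →
       IsMReachable F I FS R → IsMReachable F I FS S →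
       _≅_ F I R S)
lemma4p6 𝒞 FS F I =
  (λ X Y → reachable-M-hom⇒iso FS) ,
  (λ intersections F-preserves X R S → reachable-M-subcoalgebras-≅ FS intersections F-preserves)
  where open PointedCoalgebraProperties F I
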